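{- Let $k$ be a positive integer and let $T$ be a graph on $6k$ vertices consisting of $k$ pairwise vertex-disjoint edges. Then the edge set of $G_k=K_{6k}\setminus T$ (the complete graph on the same $6k$ vertices with the edges of $T$ removed) can be partitioned into $2k$ perfect matchings $F_1,\dots,F_{2k}$ and $4k$ near factors $E_1,\dots,E_{4k}$ in such a way that the graph formed by the $4k$ pairs uncovered by the near factors (for each $E_i$, the pair consisting of the two vertices not covered by $E_i$) is isomorphic to $H_k$, and under this isomorphism the middle of $H_k$ corresponds to the edge set of $T$.
   Context: $H_k$ is the graph with $6k$ vertices and $4k$ edges having $2k$ components, $k$ of which are paths on four vertices ($P_4$) and $k$ of which are single edges. The middle of $H_k$ is the set of middle edges of its $P_4$ components (so $k$ edges). A near factor of a graph on $2m$ vertices is a set of $m-1$ pairwise disjoint edges; here each near factor on the $6k$ vertices has $3k-1$ edges and leaves exactly two vertices uncovered. -}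

module Defs where

open import Data.Nat using (ℕ; _*_)
open import Data.Fin using (Fin; zero; suc)
open import Data.Product using (_×_; _,_; ∃-syntax; Σ-syntax)
open import Data.Sum using (_⊎_)
open import Relation.Binary.PropositionalEquality using (_≡_; _≢_)
open import Relation.Nullary using (¬_)

-- A (simple) graph on vertex set V is given by its adjacency relation.
-- Edge sets below are always symmetric and irreflexive.

Pair : {V : Set} → V → V → V → V → Set
Pair a b u v = (u ≡ a × v ≡ b) ⊎ (u ≡ b × v ≡ a)

-- T : k edges tA i — tB i on Fin n, pairwise vertex-disjoint
-- (all 2k endpoints distinct).
DisjointEdges : {k n : ℕ} → (Fin k → Fin n) → (Fin k → Fin n) → Set
DisjointEdges {k} tA tB =
  (∀ (i j : Fin k) → tA i ≢ tB j) ×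
  (∀ (i j : Fin k) → tA i ≡ tA j → i ≡ j) ×
  (∀ (i j : Fin k) → tB i ≡ tB j → i ≡ j)

TEdge : {k n : ℕ} → (Fin k → Fin n) → (Fin k → Fin n) → Fin n → Fin n → Set
TEdge tA tB u v = ∃[ i ] Pair (tA i) (tB i) u v

GEdge : {k n : ℕ} → (Fin k → Fin n) → (Fin k → Fin n) → Fin n → Fin n → Set
GEdge tA tB u v = u ≢ v × ¬ TEdge tA tB u v

-- A partition of E(G) into indexed classes is encoded by a symmetric labelling
-- c of pairs; class j consists of the edges of G with label j.
SymmetricLabel : {n : ℕ} {L : Set} → (Fin n → Fin n → L) → Set
SymmetricLabel {n} c = ∀ (u v : Fin n) → c u v ≡ c v u

ClassEdge : {k n : ℕ} {L : Set} → (Fin k → Fin n) → (Fin k → Fin n) →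
            (Fin n → Fin n → L) → L → Fin n → Fin n → Set
ClassEdge tA tB c j u v = GEdge tA tB u v × c u v ≡ j

Covered : {n : ℕ} → (Fin n → Fin n → Set) → Fin n → Set
Covered M u = ∃[ v ] M u v

PairwiseDisjoint : {n : ℕ} → (Fin n → Fin n → Set) → Set
PairwiseDisjoint {n} M = ∀ (u v w : Fin n) → M u v → M u w → v ≡ w

IsPerfectMatching : {n : ℕ} → (Fin n → Fin n → Set) → Set
IsPerfectMatching {n} M = PairwiseDisjoint M × (∀ (u : Fin n) → Covered M u)

-- near factor with uncovered pair {a , b}: pairwise disjoint edges leaving
-- exactly the two distinct vertices a, b uncovered (on 2m vertices this is
-- exactly a set of m-1 pairwise disjoint edges).
IsNearFactorMissing : {n : ℕ} → (Fin n → Fin n → Set) → Fin n → Fin n → Set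
IsNearFactorMissing {n} M a b =
  PairwiseDisjoint M × a ≢ b × ¬ Covered M a × ¬ Covered M b ×
  (∀ (u : Fin n) → u ≢ a → u ≢ b → Covered M u)

-- H_k on vertex set Fin k × Fin 6: component i has the path
-- (i,0)-(i,1)-(i,2)-(i,3) and the single edge (i,4)-(i,5).
H-base : Fin 6 → Fin 6 → Set
H-base x y =
  Pair {Fin 6} zero (suc zero) x y ⊎
  Pair {Fin 6} (suc zero) (suc (suc zero)) x y ⊎
  Pair {Fin 6} (suc (suc zero)) (suc (suc (suc zero))) x y ⊎
  Pair {Fin 6} (suc (suc (suc (suc zero)))) (suc (suc (suc (suc (suc zero))))) x y

HEdge : {k : ℕ} → Fin k × Fin 6 → Fin k × Fin 6 → Set
HEdge (i , x) (j , y) = i ≡ j × H-base x y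

HMiddle : {k : ℕ} → Fin k × Fin 6 → Fin k × Fin 6 → Set
HMiddle (i , x) (j , y) = i ≡ j × Pair {Fin 6} (suc zero) (suc (suc zero)) x y

UncoveredEdge : {m n : ℕ} → (Fin m → Fin n) → (Fin m → Fin n) → Fin n → Fin n → Set
UncoveredEdge a b u v = ∃[ i ] Pair (a i) (b i) u v

module Submission where

-- Take the patterned one-factorisation GK of K₆ₖ on ℤ₆ₖ₋₁ ∪ {∞} and place the k components of H
-- on its vertices so that the 4k edges of H get 4k distinct colours; identify the middle edges
-- with T. The other edges of H form a perfect matching M of G = K₆ₖ ∖ T. Give the edges of M a new
-- colour and every other edge of G its GK colour. An edge of H is either deleted (it is in T) or
-- recoloured (it is in M), so the class of a GK colour not used on H is still a perfect matching,
-- while the class of the colour of an edge e of H lost exactly e and is a near factor missing its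
-- ends. As GK has 6k − 1 colours, this gives 2k perfect matchings (M and the 2k − 1 colours unused
-- on H) and 4k near factors whose uncovered pairs are the edges of H. The indexings required by the
-- statement, and a placement of H whose middle edges land on T, come from extending two injections
-- between finite sets to a permutation.

open import Defs
open import Data.Empty using (⊥-elim)
open import Data.Fin using (Fin; zero; suc; toℕ; _≟_; _↑ˡ_; _↑ʳ_; splitAt; join; cast; combine; remQuot; opposite)
open import Data.Fin.Patterns using (0F; 1F; 2F; 3F; 4F; 5F)
open import Data.Fin.Properties
  using ( toℕ-injective; toℕ<n; toℕ-fromℕ; toℕ-fromℕ<; suc-injective; toℕ-cast; toℕ-↑ˡ; toℕ-↑ʳ; ↑ʳ-injective
        ; splitAt-↑ˡ; splitAt-↑ʳ; splitAt-join; join-splitAt; +↔⊎; *↔×; toℕ-combine; remQuot-combine; combine-remQuot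
        ; opposite-prop; opposite-involutive; cast-involutive )
open import Data.Fin.Permutation using (Permutation′; _⟨$⟩ʳ_; _∘ₚ_; transpose; cast-id)
import Data.Fin.Permutation as Permutation
import Data.Fin.Permutation.Components as PC
open import Data.Maybe using (Maybe; just; nothing)
open import Data.Maybe.Properties using (just-injective)
open import Data.Nat using (ℕ; zero; suc; _+_; _*_; _∸_; _≤_; _<_; s≤s; s≤s⁻¹; z≤n)
open import Data.Nat.DivMod using (_%_; _mod_; %-distribˡ-+; %-distribˡ-*; m%n%n≡m%n; [m+n]%n≡m%n; [m+kn]%n≡m%n; m<n⇒m%n≡m; m%n<n)
open import Data.Nat.Properties
  using ( +-comm; +-assoc; +-suc; +-identityʳ; *-distribʳ-+; +-cancelˡ-≡; *-cancelˡ-≡; m∸n+n≡m; m+[n∸m]≡n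
        ; <⇒≤; ≤-refl; ≤-trans; ≤-reflexive; <-≤-trans; <-irrefl; m≤m+n; m≤n+m; +-monoʳ-≤; +-monoʳ-<; *-monoʳ-≤ )
import Data.Nat.Properties as ℕ
open import Data.Nat.Tactic.RingSolver using (solve-∀)
open import Data.Product using (_×_; _,_; proj₁; proj₂; uncurry; map₂; ∃-syntax; Σ-syntax)
open import Data.Sum using (_⊎_; inj₁; inj₂; [_,_]′)
open import Function using (_∘_; _↔_; mk↔ₛ′; Injective)
open import Function.Bundles using (_⤖_; _⇔_; Bijection; Inverse; Injection; Equivalence; mk⇔)
open import Function.Construct.Composition using (_↔-∘_)
open import Function.Construct.Symmetry using (↔-sym)
open import Function.Properties.Inverse using (↔⇒↣; ↔⇒⤖)
open import Relation.Binary.PropositionalEquality hiding (J)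
open import Relation.Nullary using (¬_; yes; no)
open import Relation.Nullary.Decidable using (dec-true; dec-false)

Pair-sym : ∀ {V : Set} {a b u v : V} → Pair a b u v → Pair a b v u
Pair-sym (inj₁ (p , q)) = inj₂ (q , p)
Pair-sym (inj₂ (p , q)) = inj₁ (q , p)

Pair-map : ∀ {A B : Set} (f : A → B) {a b x y} → Pair a b x y → Pair (f a) (f b) (f x) (f y)
Pair-map f (inj₁ (p , q)) = inj₁ (cong f p , cong f q)
Pair-map f (inj₂ (p , q)) = inj₂ (cong f p , cong f q)

Pair-unmap : ∀ {A B : Set} {f : A → B} → Injective _≡_ _≡_ f →
  ∀ {a b x y} → Pair (f a) (f b) (f x) (f y) → Pair a b x y
Pair-unmap f-injective (inj₁ (p , q)) = inj₁ (f-injective p , f-injective q)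
Pair-unmap f-injective (inj₂ (p , q)) = inj₂ (f-injective p , f-injective q)

TEdge-sym : ∀ {k n} {tA tB : Fin k → Fin n} {u v} → TEdge tA tB u v → TEdge tA tB v u
TEdge-sym (i , p) = i , Pair-sym p

↔-injective : ∀ {A B : Set} (f : A ↔ B) → Injective _≡_ _≡_ (Inverse.to f)
↔-injective f = Injection.injective (↔⇒↣ f)

transpose-matchˡ : ∀ {n} (i j : Fin n) → PC.transpose i j i ≡ j
transpose-matchˡ i j rewrite dec-true (i ≟ i) refl = refl

transpose-fixes : ∀ {n} {i j k : Fin n} → k ≢ i → k ≢ j → PC.transpose i j k ≡ k
transpose-fixes {i = i} {j} {k} k≢i k≢j rewrite dec-false (k ≟ i) k≢i | dec-false (k ≟ j) k≢j = refl

injections-differ-by-permutation : ∀ {m n} (src tgt : Fin m → Fin n) →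
  Injective _≡_ _≡_ src → Injective _≡_ _≡_ tgt →
  Σ[ π ∈ Permutation′ n ] (∀ j → π ⟨$⟩ʳ src j ≡ tgt j)
injections-differ-by-permutation {zero}  src tgt _ _ = Permutation.id , λ ()
injections-differ-by-permutation {suc m} src tgt src-injective tgt-injective = π ∘ₚ transpose a (tgt zero) , agrees
  where
  rest : Σ[ π ∈ Permutation′ _ ] (∀ j → π ⟨$⟩ʳ src (suc j) ≡ tgt (suc j))
  rest = injections-differ-by-permutation (src ∘ suc) (tgt ∘ suc) (suc-injective ∘ src-injective) (suc-injective ∘ tgt-injective)
  π : Permutation′ _
  π = proj₁ rest
  a : Fin _
  a = π ⟨$⟩ʳ src zero
  agrees : ∀ j → PC.transpose a (tgt zero) (π ⟨$⟩ʳ src j) ≡ tgt j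
  agrees zero    = transpose-matchˡ a (tgt zero)
  agrees (suc j) = trans (cong (PC.transpose a (tgt zero)) (proj₂ rest j)) (transpose-fixes ≢a ≢tgt₀)
    where
    ≢a : tgt (suc j) ≢ a
    ≢a e with () ← src-injective (↔-injective π (trans (proj₂ rest j) e))
    ≢tgt₀ : tgt (suc j) ≢ tgt zero
    ≢tgt₀ e with () ← tgt-injective e

module _ {n : ℕ} where

  maybeFin : Fin n ⊎ Fin 1 → Maybe (Fin n)
  maybeFin (inj₁ x) = just x
  maybeFin (inj₂ _) = nothing

  Fin+1↔Maybe : Fin (n + 1) ↔ Maybe (Fin n)
  Fin+1↔Maybe = mk↔ₛ′ (maybeFin ∘ splitAt n) from to-from from-to
    where
    from : Maybe (Fin n) → Fin (n + 1)
    from (just x) = x ↑ˡ 1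
    from nothing  = n ↑ʳ 0F
    to-from : ∀ x → maybeFin (splitAt n (from x)) ≡ x
    to-from (just x) = cong maybeFin (splitAt-↑ˡ n x 1)
    to-from nothing  = cong maybeFin (splitAt-↑ʳ n 1 0F)
    from-to : ∀ p → from (maybeFin (splitAt n p)) ≡ p
    from-to p with splitAt n p | join-splitAt n 1 p
    ... | inj₁ x  | e = e
    ... | inj₂ 0F | e = e

  Fin+1↔Maybe-cases : ∀ p → let q = Inverse.to Fin+1↔Maybe p in
    (∃[ a ] (q ≡ just a × toℕ a ≡ toℕ p)) ⊎ (q ≡ nothing × toℕ p ≡ n)
  Fin+1↔Maybe-cases p = cases (splitAt n p) (join-splitAt n 1 p)
    where
    cases : ∀ s → join n 1 s ≡ p →
      (∃[ a ] (maybeFin s ≡ just a × toℕ a ≡ toℕ p)) ⊎ (maybeFin s ≡ nothing × toℕ p ≡ n)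
    cases (inj₁ a)  refl = inj₁ (a , refl , sym (toℕ-↑ˡ a 1))
    cases (inj₂ 0F) refl = inj₂ (refl , trans (toℕ-↑ʳ n 0F) (+-identityʳ n))

record IsOneFactorization {V C : Set} (colour : V → V → C) : Set where
  field
    symmetric  : ∀ u v → colour u v ≡ colour v u
    injective  : ∀ {u v w} → u ≢ v → u ≢ w → colour u v ≡ colour u w → v ≡ w
    surjective : ∀ u s → ∃[ w ] (u ≢ w × colour u w ≡ s)

isOneFactorization-pullback : ∀ {U V C : Set} {colour : V → V → C} (f : U ↔ V) →
  IsOneFactorization colour → IsOneFactorization (λ u v → colour (Inverse.to f u) (Inverse.to f v))
isOneFactorization-pullback {colour = colour} f isOF = record
  { symmetric  = λ u v → symmetric (to u) (to v)
  ; injective  = λ u≢v u≢w e → ↔-injective f (injective (u≢v ∘ ↔-injective f) (u≢w ∘ ↔-injective f) e)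
  ; surjective = pulled
  }
  where
  open IsOneFactorization isOF
  open Inverse f using (to; from; strictlyInverseˡ)
  pulled : ∀ u s → ∃[ w ] (u ≢ w × colour (to u) (to w) ≡ s)
  pulled u s with surjective (to u) s
  ... | w , u≢w , e = from w , (λ e′ → u≢w (trans (cong to e′) (strictlyInverseˡ w))) ,
                      trans (cong (colour (to u)) (strictlyInverseˡ w)) e

-- The patterned one-factorisation of K (n + 1) for odd n = 2h + 1, on the vertices ℤₙ ∪ {∞}
-- with ∞ = nothing: the edge {x , y} has colour x + y and the edge {x , ∞} has colour 2x.
module GK (h : ℕ) where

  n : ℕ
  n = suc (h + h)

  _⊕_ : Fin n → Fin n → Fin n
  x ⊕ y = (toℕ x + toℕ y) mod n

  toℕ-mod : ∀ a → toℕ (a mod n) ≡ a % n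
  toℕ-mod a = toℕ-fromℕ< (m%n<n a n)

  toℕ-⊕ : ∀ x y → toℕ (x ⊕ y) ≡ (toℕ x + toℕ y) % n
  toℕ-⊕ x y = toℕ-mod (toℕ x + toℕ y)

  ⊕-comm : ∀ x y → x ⊕ y ≡ y ⊕ x
  ⊕-comm x y = cong (_mod n) (+-comm (toℕ x) (toℕ y))

  %-absorbʳ-+ : ∀ a b → (a + b % n) % n ≡ (a + b) % n
  %-absorbʳ-+ a b = begin
    (a + b % n) % n         ≡⟨ %-distribˡ-+ a (b % n) n ⟩
    (a % n + b % n % n) % n ≡⟨ cong (λ z → (a % n + z) % n) (m%n%n≡m%n b n) ⟩
    (a % n + b % n) % n     ≡⟨ %-distribˡ-+ a b n ⟨
    (a + b) % n             ∎
    where open ≡-Reasoning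

  %-absorbˡ-* : ∀ a b → (a % n * b) % n ≡ (a * b) % n
  %-absorbˡ-* a b = begin
    (a % n * b) % n           ≡⟨ %-distribˡ-* (a % n) b n ⟩
    (a % n % n * (b % n)) % n ≡⟨ cong (λ z → (z * (b % n)) % n) (m%n%n≡m%n a n) ⟩
    (a % n * (b % n)) % n     ≡⟨ %-distribˡ-* a b n ⟨
    (a * b) % n               ∎
    where open ≡-Reasoning

  [n+v]%n≡v : ∀ {v} → v < n → (n + v) % n ≡ v
  [n+v]%n≡v {v} v<n = trans (cong (_% n) (+-comm n v)) (trans ([m+n]%n≡m%n v n) (m<n⇒m%n≡m v<n))

  [y+yn]%n≡y : ∀ (y : Fin n) → (toℕ y + toℕ y * n) % n ≡ toℕ y
  [y+yn]%n≡y y = trans ([m+kn]%n≡m%n (toℕ y) (toℕ y) n) (m<n⇒m%n≡m (toℕ<n y))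

  ⊕-inverseˡ : ∀ x y → (n ∸ toℕ x + toℕ (x ⊕ y)) % n ≡ toℕ y
  ⊕-inverseˡ x y = begin
    (n ∸ toℕ x + toℕ (x ⊕ y)) % n         ≡⟨ cong (λ z → (n ∸ toℕ x + z) % n) (toℕ-⊕ x y) ⟩
    (n ∸ toℕ x + (toℕ x + toℕ y) % n) % n ≡⟨ %-absorbʳ-+ (n ∸ toℕ x) (toℕ x + toℕ y) ⟩
    (n ∸ toℕ x + (toℕ x + toℕ y)) % n     ≡⟨ cong (_% n) (+-assoc (n ∸ toℕ x) (toℕ x) (toℕ y)) ⟨
    (n ∸ toℕ x + toℕ x + toℕ y) % n       ≡⟨ cong (λ z → (z + toℕ y) % n) (m∸n+n≡m (<⇒≤ (toℕ<n x))) ⟩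
    (n + toℕ y) % n                       ≡⟨ [n+v]%n≡v (toℕ<n y) ⟩
    toℕ y                                 ∎
    where open ≡-Reasoning

  ⊕-cancelˡ : ∀ x {y z} → x ⊕ y ≡ x ⊕ z → y ≡ z
  ⊕-cancelˡ x {y} {z} e = toℕ-injective (begin
    toℕ y                         ≡⟨ ⊕-inverseˡ x y ⟨
    (n ∸ toℕ x + toℕ (x ⊕ y)) % n ≡⟨ cong (λ s → (n ∸ toℕ x + toℕ s) % n) e ⟩
    (n ∸ toℕ x + toℕ (x ⊕ z)) % n ≡⟨ ⊕-inverseˡ x z ⟩
    toℕ z                         ∎)
    where open ≡-Reasoning

  ⊕-solve : ∀ x s → x ⊕ ((n ∸ toℕ x + toℕ s) mod n) ≡ s
  ⊕-solve x s = toℕ-injective (begin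
    toℕ (x ⊕ ((n ∸ toℕ x + toℕ s) mod n))        ≡⟨ toℕ-⊕ x _ ⟩
    (toℕ x + toℕ ((n ∸ toℕ x + toℕ s) mod n)) % n ≡⟨ cong (λ z → (toℕ x + z) % n) (toℕ-mod (n ∸ toℕ x + toℕ s)) ⟩
    (toℕ x + (n ∸ toℕ x + toℕ s) % n) % n        ≡⟨ %-absorbʳ-+ (toℕ x) _ ⟩
    (toℕ x + (n ∸ toℕ x + toℕ s)) % n            ≡⟨ cong (_% n) (+-assoc (toℕ x) _ (toℕ s)) ⟨
    (toℕ x + (n ∸ toℕ x) + toℕ s) % n            ≡⟨ cong (λ z → (z + toℕ s) % n) (m+[n∸m]≡n (<⇒≤ (toℕ<n x))) ⟩
    (n + toℕ s) % n                              ≡⟨ [n+v]%n≡v (toℕ<n s) ⟩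
    toℕ s                                        ∎)
    where open ≡-Reasoning

  -- suc h is the inverse of 2 modulo n
  half : Fin n → Fin n
  half s = (toℕ s * suc h) mod n

  double-suc-h : ∀ a → (a + a) * suc h ≡ a + a * n
  double-suc-h a = lemma a h
    where
    lemma : ∀ a h → (a + a) * suc h ≡ a + a * suc (h + h)
    lemma = solve-∀

  half-double : ∀ x → half (x ⊕ x) ≡ x
  half-double x = toℕ-injective (begin
    toℕ (half (x ⊕ x))                ≡⟨ toℕ-mod (toℕ (x ⊕ x) * suc h) ⟩
    (toℕ (x ⊕ x) * suc h) % n         ≡⟨ cong (λ z → (z * suc h) % n) (toℕ-⊕ x x) ⟩
    ((toℕ x + toℕ x) % n * suc h) % n ≡⟨ %-absorbˡ-* (toℕ x + toℕ x) (suc h) ⟩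
    ((toℕ x + toℕ x) * suc h) % n     ≡⟨ cong (_% n) (double-suc-h (toℕ x)) ⟩
    (toℕ x + toℕ x * n) % n           ≡⟨ [y+yn]%n≡y x ⟩
    toℕ x                             ∎)
    where open ≡-Reasoning

  double-half : ∀ s → half s ⊕ half s ≡ s
  double-half s = toℕ-injective (begin
    toℕ (half s ⊕ half s)                           ≡⟨ toℕ-⊕ (half s) (half s) ⟩
    (toℕ (half s) + toℕ (half s)) % n               ≡⟨ cong (λ z → (z + z) % n) (toℕ-mod (toℕ s * suc h)) ⟩
    ((toℕ s * suc h) % n + (toℕ s * suc h) % n) % n ≡⟨ %-distribˡ-+ (toℕ s * suc h) (toℕ s * suc h) n ⟨
    (toℕ s * suc h + toℕ s * suc h) % n             ≡⟨ cong (_% n) (*-distribʳ-+ (suc h) (toℕ s) (toℕ s)) ⟨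
    ((toℕ s + toℕ s) * suc h) % n                   ≡⟨ cong (_% n) (double-suc-h (toℕ s)) ⟩
    (toℕ s + toℕ s * n) % n                         ≡⟨ [y+yn]%n≡y s ⟩
    toℕ s                                           ∎)
    where open ≡-Reasoning

  double-injective : ∀ {x y} → x ⊕ x ≡ y ⊕ y → x ≡ y
  double-injective {x} {y} e = trans (sym (half-double x)) (trans (cong half e) (half-double y))

  -- the colour of the loop at ∞ is a junk value
  gk : Maybe (Fin n) → Maybe (Fin n) → Fin n
  gk (just x) (just y) = x ⊕ y
  gk (just x) nothing  = x ⊕ x
  gk nothing  (just y) = y ⊕ y
  gk nothing  nothing  = zero

  gk-symmetric : ∀ u v → gk u v ≡ gk v u
  gk-symmetric (just x) (just y) = ⊕-comm x y
  gk-symmetric (just x) nothing  = refl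
  gk-symmetric nothing  (just y) = refl
  gk-symmetric nothing  nothing  = refl

  gk-injective : ∀ {u v w} → u ≢ v → u ≢ w → gk u v ≡ gk u w → v ≡ w
  gk-injective {nothing} {nothing}           u≢v _   _ = ⊥-elim (u≢v refl)
  gk-injective {nothing} {just _} {nothing}  _   u≢w _ = ⊥-elim (u≢w refl)
  gk-injective {nothing} {just _} {just _}   _   _   e = cong just (double-injective e)
  gk-injective {just _}  {nothing} {nothing} _   _   _ = refl
  gk-injective {just x}  {nothing} {just _}  _   u≢w e = ⊥-elim (u≢w (cong just (⊕-cancelˡ x e)))
  gk-injective {just x}  {just _} {nothing}  u≢v _   e = ⊥-elim (u≢v (cong just (sym (⊕-cancelˡ x e))))
  gk-injective {just x}  {just _} {just _}   _   _   e = cong just (⊕-cancelˡ x e)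

  gk-surjective : ∀ u s → ∃[ w ] (u ≢ w × gk u w ≡ s)
  gk-surjective nothing  s = just (half s) , (λ ()) , double-half s
  gk-surjective (just x) s with (n ∸ toℕ x + toℕ s) mod n ≟ x
  ... | yes y≡x = nothing , (λ ()) , trans (cong (x ⊕_) (sym y≡x)) (⊕-solve x s)
  ... | no  y≢x = just _ , (λ e → y≢x (sym (just-injective e))) , ⊕-solve x s

  gk-isOneFactorization : IsOneFactorization gk
  gk-isOneFactorization = record
    { symmetric  = gk-symmetric
    ; injective  = gk-injective
    ; surjective = gk-surjective
    }

-- Perfect matchings and near factors from a one-factorisation

module NearFactorization
  {k N : ℕ} (tA tB : Fin k → Fin N)
  {C : Set} {colour : Fin N → Fin N → C} (isOF : IsOneFactorization colour)
  (mate : Fin N → Fin N)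
  (mate-involutive : ∀ u → mate (mate u) ≡ u)
  (mate-irreflexive : ∀ u → u ≢ mate u)
  {E : Set} (end₁ end₂ : E → Fin N)
  (ends-distinct : ∀ e → end₁ e ≢ end₂ e)
  (edgeColour-injective : ∀ {e e′} → colour (end₁ e) (end₂ e) ≡ colour (end₁ e′) (end₂ e′) → e ≡ e′)
  (T⊆H : ∀ {u v} → TEdge tA tB u v → ∃[ e ] Pair (end₁ e) (end₂ e) u v)
  (M⊆H : ∀ u → ∃[ e ] Pair (end₁ e) (end₂ e) u (mate u))
  (H⊆T∪M : ∀ e → TEdge tA tB (end₁ e) (end₂ e) ⊎ end₂ e ≡ mate (end₁ e))
  (T∩M≡∅ : ∀ u → ¬ TEdge tA tB u (mate u))
  {L : Set} (relabel : Maybe C → L) (relabel-injective : Injective _≡_ _≡_ relabel)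
  where

  open IsOneFactorization isOF

  edgeColour : E → C
  edgeColour e = colour (end₁ e) (end₂ e)

  InH : Fin N → Fin N → Set
  InH u v = ∃[ e ] Pair (end₁ e) (end₂ e) u v

  extended : Fin N → Fin N → Maybe C
  extended u v with v ≟ mate u
  ... | yes _ = nothing
  ... | no  _ = just (colour u v)

  label : Fin N → Fin N → L
  label u v = relabel (extended u v)

  Class : Maybe C → Fin N → Fin N → Set
  Class x = ClassEdge tA tB label (relabel x)

  mate-swap : ∀ {u v} → v ≡ mate u → u ≡ mate v
  mate-swap refl = sym (mate-involutive _)

  extended-mate : ∀ u → extended u (mate u) ≡ nothing
  extended-mate u with mate u ≟ mate u
  ... | yes _   = refl
  ... | no  ≢mu = ⊥-elim (≢mu refl)

  extended-off-mate : ∀ {u v} → v ≢ mate u → extended u v ≡ just (colour u v)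
  extended-off-mate {u} {v} v≢mu with v ≟ mate u
  ... | yes v≡mu = ⊥-elim (v≢mu v≡mu)
  ... | no  _    = refl

  extended-just : ∀ {u v s} → extended u v ≡ just s → colour u v ≡ s
  extended-just {u} {v} e with v ≟ mate u
  extended-just () | yes _
  extended-just e  | no _ = just-injective e

  extended-symmetric : ∀ u v → extended u v ≡ extended v u
  extended-symmetric u v with v ≟ mate u | u ≟ mate v
  ... | yes _ | yes _ = refl
  ... | yes p | no  q = ⊥-elim (q (mate-swap p))
  ... | no  p | yes q = ⊥-elim (p (mate-swap q))
  ... | no  _ | no  _ = cong just (symmetric u v)

  extended-injective : ∀ {u v w} → u ≢ v → u ≢ w → extended u v ≡ extended u w → v ≡ w
  extended-injective {u} {v} {w} u≢v u≢w e with v ≟ mate u | w ≟ mate u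
  extended-injective _   _   _  | yes v≡mu | yes w≡mu = trans v≡mu (sym w≡mu)
  extended-injective _   _   () | yes _    | no _
  extended-injective _   _   () | no _     | yes _
  extended-injective u≢v u≢w e  | no _     | no _     = injective u≢v u≢w (just-injective e)

  label-symmetric : SymmetricLabel label
  label-symmetric u v = cong relabel (extended-symmetric u v)

  class-disjoint : ∀ x → PairwiseDisjoint (Class x)
  class-disjoint x u v w (g , e) (g′ , e′) =
    extended-injective (proj₁ g) (proj₁ g′) (relabel-injective (trans e (sym e′)))

  class-colour : ∀ {s u v} → Class (just s) u v → colour u v ≡ s
  class-colour (_ , e) = extended-just (relabel-injective e)

  InH-colour : ∀ {e u v} → Pair (end₁ e) (end₂ e) u v → colour u v ≡ edgeColour e
  InH-colour (inj₁ (refl , refl)) = refl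
  InH-colour (inj₂ (refl , refl)) = symmetric _ _

  InH-distinct : ∀ {e u v} → Pair (end₁ e) (end₂ e) u v → u ≢ v
  InH-distinct {e} (inj₁ (refl , refl)) = ends-distinct e
  InH-distinct {e} (inj₂ (refl , refl)) = ends-distinct e ∘ sym

  InH-T∪M : ∀ {e u v} → Pair (end₁ e) (end₂ e) u v → TEdge tA tB u v ⊎ v ≡ mate u
  InH-T∪M {e} p with H⊆T∪M e | p
  ... | inj₁ t | inj₁ (refl , refl) = inj₁ t
  ... | inj₁ t | inj₂ (refl , refl) = inj₁ (TEdge-sym t)
  ... | inj₂ m | inj₁ (refl , refl) = inj₂ m
  ... | inj₂ m | inj₂ (refl , refl) = inj₂ (mate-swap m)

  InH-uncoloured : ∀ {e u v s} → Pair (end₁ e) (end₂ e) u v → ¬ Class (just s) u v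
  InH-uncoloured p ((_ , ¬T) , lab) with InH-T∪M p
  ... | inj₁ t    = ¬T t
  ... | inj₂ refl with () ← trans (sym (extended-mate _)) (relabel-injective lab)

  coloured-outside-H : ∀ {u w s} → u ≢ w → colour u w ≡ s → ¬ InH u w → Class (just s) u w
  coloured-outside-H {u} u≢w c≡s ∉H =
    (u≢w , ∉H ∘ T⊆H) ,
    cong relabel (trans (extended-off-mate λ { refl → ∉H (M⊆H u) }) (cong just c≡s))

  mate-perfect : IsPerfectMatching (Class nothing)
  mate-perfect = class-disjoint nothing , λ u → mate u , (mate-irreflexive u , T∩M≡∅ u) , cong relabel (extended-mate u)

  colour-perfect : ∀ s → (∀ e → edgeColour e ≢ s) → IsPerfectMatching (Class (just s))
  colour-perfect s avoids = class-disjoint (just s) , cover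
    where
    cover : ∀ u → Covered (Class (just s)) u
    cover u with surjective u s
    ... | w , u≢w , c = w , coloured-outside-H u≢w c λ (e , p) → avoids e (trans (sym (InH-colour p)) c)

  class-perfect : ∀ x → (∀ e → x ≢ just (edgeColour e)) → IsPerfectMatching (Class x)
  class-perfect nothing  _      = mate-perfect
  class-perfect (just s) avoids = colour-perfect s λ e c≡s → avoids e (cong just (sym c≡s))

  InH-uncovered : ∀ e {u v} → Pair (end₁ e) (end₂ e) u v → ¬ Covered (Class (just (edgeColour e))) u
  InH-uncovered e p (w , cw@((u≢w , _) , _))
    with refl ← injective u≢w (InH-distinct p) (trans (class-colour cw) (sym (InH-colour p)))
    = InH-uncoloured p cw

  class-nearFactor : ∀ e → IsNearFactorMissing (Class (just (edgeColour e))) (end₁ e) (end₂ e)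
  class-nearFactor e =
    class-disjoint _ , ends-distinct e ,
    InH-uncovered e (inj₁ (refl , refl)) , InH-uncovered e (inj₂ (refl , refl)) , cover
    where
    cover : ∀ u → u ≢ end₁ e → u ≢ end₂ e → Covered (Class (just (edgeColour e))) u
    cover u u≢a u≢b with surjective u (edgeColour e)
    ... | w , u≢w , c = w , coloured-outside-H u≢w c ∉H
      where
      ∉H : ¬ InH u w
      ∉H (e′ , p) with refl ← edgeColour-injective (trans (sym (InH-colour p)) c) | p
      ... | inj₁ (u≡a , _) = u≢a u≡a
      ... | inj₂ (u≡b , _) = u≢b u≡b

edgeEnd₁ edgeEnd₂ : Fin 4 → Fin 6
edgeEnd₁ 0F = 0F
edgeEnd₁ 1F = 1F
edgeEnd₁ 2F = 2F
edgeEnd₁ 3F = 4F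
edgeEnd₂ 0F = 1F
edgeEnd₂ 1F = 2F
edgeEnd₂ 2F = 3F
edgeEnd₂ 3F = 5F

edgeEnds-distinct : ∀ t → edgeEnd₁ t ≢ edgeEnd₂ t
edgeEnds-distinct 0F ()
edgeEnds-distinct 1F ()
edgeEnds-distinct 2F ()
edgeEnds-distinct 3F ()

H-base⇔edge : ∀ x y → H-base x y ⇔ (∃[ t ] Pair (edgeEnd₁ t) (edgeEnd₂ t) x y)
H-base⇔edge x y = mk⇔ to from
  where
  to : H-base x y → ∃[ t ] Pair (edgeEnd₁ t) (edgeEnd₂ t) x y
  to (inj₁ p)               = 0F , p
  to (inj₂ (inj₁ p))        = 1F , p
  to (inj₂ (inj₂ (inj₁ p))) = 2F , p
  to (inj₂ (inj₂ (inj₂ p))) = 3F , p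
  from : ∃[ t ] Pair (edgeEnd₁ t) (edgeEnd₂ t) x y → H-base x y
  from (0F , p) = inj₁ p
  from (1F , p) = inj₂ (inj₁ p)
  from (2F , p) = inj₂ (inj₂ (inj₁ p))
  from (3F , p) = inj₂ (inj₂ (inj₂ p))

partner : Fin 6 → Fin 6
partner 0F = 1F
partner 1F = 0F
partner 2F = 3F
partner 3F = 2F
partner 4F = 5F
partner 5F = 4F

partner-involutive : ∀ r → partner (partner r) ≡ r
partner-involutive 0F = refl
partner-involutive 1F = refl
partner-involutive 2F = refl
partner-involutive 3F = refl
partner-involutive 4F = refl
partner-involutive 5F = refl

partner-irreflexive : ∀ r → r ≢ partner r
partner-irreflexive 0F ()
partner-irreflexive 1F ()
partner-irreflexive 2F ()
partner-irreflexive 3F ()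
partner-irreflexive 4F ()
partner-irreflexive 5F ()

partner-edge : ∀ r → ∃[ t ] Pair (edgeEnd₁ t) (edgeEnd₂ t) r (partner r)
partner-edge 0F = 0F , inj₁ (refl , refl)
partner-edge 1F = 0F , inj₂ (refl , refl)
partner-edge 2F = 2F , inj₁ (refl , refl)
partner-edge 3F = 2F , inj₂ (refl , refl)
partner-edge 4F = 3F , inj₁ (refl , refl)
partner-edge 5F = 3F , inj₂ (refl , refl)

edge-middle-or-partner : ∀ t → t ≡ 1F ⊎ edgeEnd₂ t ≡ partner (edgeEnd₁ t)
edge-middle-or-partner 0F = inj₂ refl
edge-middle-or-partner 1F = inj₁ refl
edge-middle-or-partner 2F = inj₂ refl
edge-middle-or-partner 3F = inj₂ refl

-- Placing H on the vertices of GK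

module Layout (m : ℕ) where

  k : ℕ
  k = suc m

  X : Set
  X = Fin k × Fin 6

  open GK (2 + 3 * m) public

  -- Vertex (i , r) gets label place r i, where opposite i is m - i: the vertices 1 and 4 take the
  -- labels below 2k alternately and the others fill four reversed blocks of length k.
  -- The largest label n, of (0 , 0), is ∞.
  place : Fin 6 → Fin k → ℕ
  place 0F i = 5 * k + toℕ (opposite i)
  place 1F i = 2 * toℕ i
  place 2F i = 4 * k + toℕ (opposite i)
  place 3F i = 3 * k + toℕ (opposite i)
  place 4F i = suc (2 * toℕ i)
  place 5F i = 2 * k + toℕ (opposite i)

  position : X → Fin (k * 2) ⊎ Fin (4 * k)
  position (i , 0F) = inj₂ (combine {4} 3F (opposite i))
  position (i , 1F) = inj₁ (combine i 0F)
  position (i , 2F) = inj₂ (combine {4} 2F (opposite i))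
  position (i , 3F) = inj₂ (combine {4} 1F (opposite i))
  position (i , 4F) = inj₁ (combine i 1F)
  position (i , 5F) = inj₂ (combine {4} 0F (opposite i))

  interlaced : Fin k × Fin 2 → X
  interlaced (i , 0F) = i , 1F
  interlaced (i , 1F) = i , 4F

  reversed : Fin 4 × Fin k → X
  reversed (0F , j) = opposite j , 5F
  reversed (1F , j) = opposite j , 3F
  reversed (2F , j) = opposite j , 2F
  reversed (3F , j) = opposite j , 0F

  unposition : Fin (k * 2) ⊎ Fin (4 * k) → X
  unposition (inj₁ p) = interlaced (remQuot 2 p)
  unposition (inj₂ p) = reversed (remQuot k p)

  unposition-position : ∀ x → unposition (position x) ≡ x
  unposition-position (i , 0F) = trans (cong reversed (remQuot-combine {4} 3F (opposite i))) (cong (_, 0F) (opposite-involutive i))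
  unposition-position (i , 1F) = cong interlaced (remQuot-combine i 0F)
  unposition-position (i , 2F) = trans (cong reversed (remQuot-combine {4} 2F (opposite i))) (cong (_, 2F) (opposite-involutive i))
  unposition-position (i , 3F) = trans (cong reversed (remQuot-combine {4} 1F (opposite i))) (cong (_, 3F) (opposite-involutive i))
  unposition-position (i , 4F) = cong interlaced (remQuot-combine i 1F)
  unposition-position (i , 5F) = trans (cong reversed (remQuot-combine {4} 0F (opposite i))) (cong (_, 5F) (opposite-involutive i))

  position-interlaced : ∀ q → position (interlaced q) ≡ inj₁ (uncurry combine q)
  position-interlaced (i , 0F) = refl
  position-interlaced (i , 1F) = refl

  position-reversed : ∀ q → position (reversed q) ≡ inj₂ (uncurry combine q)
  position-reversed (0F , j) = cong (inj₂ ∘ combine {4} 0F) (opposite-involutive j)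
  position-reversed (1F , j) = cong (inj₂ ∘ combine {4} 1F) (opposite-involutive j)
  position-reversed (2F , j) = cong (inj₂ ∘ combine {4} 2F) (opposite-involutive j)
  position-reversed (3F , j) = cong (inj₂ ∘ combine {4} 3F) (opposite-involutive j)

  position-unposition : ∀ p → position (unposition p) ≡ p
  position-unposition (inj₁ p) = trans (position-interlaced (remQuot 2 p)) (cong inj₁ (combine-remQuot {k} 2 p))
  position-unposition (inj₂ p) = trans (position-reversed (remQuot k p)) (cong inj₂ (combine-remQuot {4} k p))

  positions : ∀ {N} → k * 2 + 4 * k ≡ N → X ↔ Fin N
  positions eq = cast-id eq ↔-∘ (↔-sym +↔⊎ ↔-∘ mk↔ₛ′ position unposition position-unposition unposition-position)

  toℕ-interlaced : ∀ (i : Fin k) (b : Fin 2) → toℕ (join (k * 2) (4 * k) (inj₁ (combine i b))) ≡ 2 * toℕ i + toℕ b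
  toℕ-interlaced i b = trans (toℕ-↑ˡ (combine i b) (4 * k)) (toℕ-combine i b)

  toℕ-reversed : ∀ (j : Fin 4) (i : Fin k) →
    toℕ (join (k * 2) (4 * k) (inj₂ (combine j (opposite i)))) ≡ (2 + toℕ j) * k + toℕ (opposite i)
  toℕ-reversed j i = trans (toℕ-↑ʳ (k * 2) _) (trans (cong (k * 2 +_) (toℕ-combine j (opposite i))) (shift (toℕ j) k (toℕ (opposite i))))
    where
    shift : ∀ a k l → k * 2 + (k * a + l) ≡ (2 + a) * k + l
    shift = solve-∀

  toℕ-positions : ∀ {N} (eq : k * 2 + 4 * k ≡ N) i r → toℕ (Inverse.to (positions eq) (i , r)) ≡ place r i
  toℕ-positions eq i r = trans (toℕ-cast eq _) (toℕ-position r)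
    where
    toℕ-position : ∀ r → toℕ (join (k * 2) (4 * k) (position (i , r))) ≡ place r i
    toℕ-position 0F = toℕ-reversed 3F i
    toℕ-position 1F = trans (toℕ-interlaced i 0F) (+-identityʳ (2 * toℕ i))
    toℕ-position 2F = toℕ-reversed 2F i
    toℕ-position 3F = toℕ-reversed 1F i
    toℕ-position 4F = trans (toℕ-interlaced i 1F) (+-comm (2 * toℕ i) 1)
    toℕ-position 5F = toℕ-reversed 0F i

  size : k * 2 + 4 * k ≡ n + 1
  size = lemma m
    where
    lemma : ∀ a → suc a * 2 + 4 * suc a ≡ suc ((2 + 3 * a) + (2 + 3 * a)) + 1
    lemma = solve-∀

  n≡5k+m : n ≡ 5 * k + m
  n≡5k+m = lemma m
    where
    lemma : ∀ a → suc ((2 + 3 * a) + (2 + 3 * a)) ≡ 5 * suc a + a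
    lemma = solve-∀

  n≡4k+2m+1 : n ≡ 4 * k + suc (m + m)
  n≡4k+2m+1 = lemma m
    where
    lemma : ∀ a → suc ((2 + 3 * a) + (2 + 3 * a)) ≡ 4 * suc a + suc (a + a)
    lemma = solve-∀

  vertices : X ↔ Maybe (Fin n)
  vertices = Fin+1↔Maybe ↔-∘ positions size

  vertex : X → Maybe (Fin n)
  vertex = Inverse.to vertices

  top : X
  top = zero , 0F

  place-top : place 0F zero ≡ n
  place-top = trans (cong (5 * k +_) (toℕ-fromℕ m)) (sym n≡5k+m)

  vertex-top : vertex top ≡ nothing
  vertex-top with Fin+1↔Maybe-cases (Inverse.to (positions size) top)
  ... | inj₂ (e , _)       = e
  ... | inj₁ (a , _ , a≡p) = ⊥-elim (<-irrefl (trans a≡p (trans (toℕ-positions size zero 0F) place-top)) (toℕ<n a))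

  vertex-finite : ∀ {i r} → (i , r) ≢ top → ∃[ a ] (vertex (i , r) ≡ just a × toℕ a ≡ place r i)
  vertex-finite {i} {r} ≢top with Fin+1↔Maybe-cases (Inverse.to (positions size) (i , r))
  ... | inj₁ (a , e , a≡p) = a , e , trans a≡p (toℕ-positions size i r)
  ... | inj₂ (_ , p≡n)     = ⊥-elim (≢top (↔-injective (positions size) (toℕ-injective (begin
    toℕ (Inverse.to (positions size) (i , r))   ≡⟨ p≡n ⟩
    n                                           ≡⟨ place-top ⟨
    place 0F zero                               ≡⟨ toℕ-positions size zero 0F ⟨
    toℕ (Inverse.to (positions size) top)       ∎))))
    where open ≡-Reasoning

  gk-finite : ∀ i r i′ r′ → (i , r) ≢ top → (i′ , r′) ≢ top →
    toℕ (gk (vertex (i , r)) (vertex (i′ , r′))) ≡ (place r i + place r′ i′) % n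
  gk-finite i r i′ r′ ≢top ≢top′ with vertex-finite ≢top | vertex-finite ≢top′
  ... | a , e , a≡p | a′ , e′ , a′≡p′ rewrite e | e′ = trans (toℕ-⊕ a a′) (cong₂ (λ p q → (p + q) % n) a≡p a′≡p′)

  toℕ+opposite : ∀ (i : Fin k) → toℕ i + toℕ (opposite i) ≡ m
  toℕ+opposite i = trans (cong (toℕ i +_) (opposite-prop i)) (m+[n∸m]≡n (s≤s⁻¹ (toℕ<n i)))

  -- The value of hEdgeColour (t , i); the four kinds t of edges occupy disjoint bands [lower t , upper t).
  colourValue : Fin 4 → Fin k → ℕ
  colourValue 0F i = toℕ i
  colourValue 1F i = 4 * k + (m + toℕ i)
  colourValue 2F i = k + suc (2 * toℕ (opposite i))
  colourValue 3F i = 3 * k + toℕ i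

  lower upper : Fin 4 → ℕ
  lower 0F = 0
  lower 1F = 4 * k
  lower 2F = k
  lower 3F = 3 * k
  upper 0F = k
  upper 1F = 4 * k + suc (m + m)
  upper 2F = 3 * k
  upper 3F = 4 * k

  colourValue-band : ∀ t i → lower t ≤ colourValue t i × colourValue t i < upper t
  colourValue-band 0F i = z≤n , toℕ<n i
  colourValue-band 1F i = m≤m+n (4 * k) _ , +-monoʳ-< (4 * k) (s≤s (+-monoʳ-≤ m (s≤s⁻¹ (toℕ<n i))))
  colourValue-band 2F i = m≤m+n k _ , +-monoʳ-< k (subst (_≤ 2 * k) (cong suc (+-suc j (j + 0))) (*-monoʳ-≤ 2 (toℕ<n (opposite i))))
    where
    j : ℕ
    j = toℕ (opposite i)
  colourValue-band 3F i = m≤m+n (3 * k) _ , subst (3 * k + toℕ i <_) (+-comm (3 * k) k) (+-monoʳ-< (3 * k) (toℕ<n i))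

  4k≤n : 4 * k ≤ n
  4k≤n = ≤-trans (m≤m+n (4 * k) _) (≤-reflexive (sym n≡4k+2m+1))

  upper≤n : ∀ t → upper t ≤ n
  upper≤n 0F = ≤-trans (m≤m+n k (3 * k)) 4k≤n
  upper≤n 1F = ≤-reflexive (sym n≡4k+2m+1)
  upper≤n 2F = ≤-trans (m≤n+m (3 * k) k) 4k≤n
  upper≤n 3F = 4k≤n

  colourValue<n : ∀ t i → colourValue t i < n
  colourValue<n t i = <-≤-trans (proj₂ (colourValue-band t i)) (upper≤n t)

  colourValues-apart : ∀ t t′ i i′ → upper t ≤ lower t′ → colourValue t i ≢ colourValue t′ i′
  colourValues-apart t t′ i i′ separated e =
    <-irrefl e (<-≤-trans (proj₂ (colourValue-band t i)) (≤-trans separated (proj₁ (colourValue-band t′ i′))))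

  colourValue-injective : ∀ {t t′ i i′} → colourValue t i ≡ colourValue t′ i′ → (t , i) ≡ (t′ , i′)
  colourValue-injective {0F} {0F} e = cong (0F ,_) (toℕ-injective e)
  colourValue-injective {1F} {1F} e = cong (1F ,_) (toℕ-injective (+-cancelˡ-≡ m _ _ (+-cancelˡ-≡ (4 * k) _ _ e)))
  colourValue-injective {2F} {2F} {i} {i′} e = cong (2F ,_) (begin
    i                      ≡⟨ opposite-involutive i ⟨
    opposite (opposite i)  ≡⟨ cong opposite (toℕ-injective {i = opposite i} {j = opposite i′} (*-cancelˡ-≡ _ _ 2 (ℕ.suc-injective (+-cancelˡ-≡ k _ _ e)))) ⟩
    opposite (opposite i′) ≡⟨ opposite-involutive i′ ⟩
    i′                     ∎)
    where open ≡-Reasoning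
  colourValue-injective {3F} {3F} e = cong (3F ,_) (toℕ-injective (+-cancelˡ-≡ (3 * k) _ _ e))
  colourValue-injective {0F} {1F} {i} {i′} e = ⊥-elim (colourValues-apart 0F 1F i i′ (m≤m+n k (3 * k)) e)
  colourValue-injective {0F} {2F} {i} {i′} e = ⊥-elim (colourValues-apart 0F 2F i i′ ≤-refl e)
  colourValue-injective {0F} {3F} {i} {i′} e = ⊥-elim (colourValues-apart 0F 3F i i′ (m≤m+n k (2 * k)) e)
  colourValue-injective {1F} {0F} {i} {i′} e = ⊥-elim (colourValues-apart 0F 1F i′ i (m≤m+n k (3 * k)) (sym e))
  colourValue-injective {1F} {2F} {i} {i′} e = ⊥-elim (colourValues-apart 2F 1F i′ i (m≤n+m (3 * k) k) (sym e))
  colourValue-injective {1F} {3F} {i} {i′} e = ⊥-elim (colourValues-apart 3F 1F i′ i ≤-refl (sym e))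
  colourValue-injective {2F} {0F} {i} {i′} e = ⊥-elim (colourValues-apart 0F 2F i′ i ≤-refl (sym e))
  colourValue-injective {2F} {1F} {i} {i′} e = ⊥-elim (colourValues-apart 2F 1F i i′ (m≤n+m (3 * k) k) e)
  colourValue-injective {2F} {3F} {i} {i′} e = ⊥-elim (colourValues-apart 2F 3F i i′ ≤-refl e)
  colourValue-injective {3F} {0F} {i} {i′} e = ⊥-elim (colourValues-apart 0F 3F i′ i (m≤m+n k (2 * k)) (sym e))
  colourValue-injective {3F} {1F} {i} {i′} e = ⊥-elim (colourValues-apart 3F 1F i i′ ≤-refl e)
  colourValue-injective {3F} {2F} {i} {i′} e = ⊥-elim (colourValues-apart 2F 3F i′ i ≤-refl (sym e))

  regroup₀ : ∀ c i j → c + j + 2 * i ≡ c + (i + j) + i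
  regroup₀ = solve-∀

  regroup₁ : ∀ c i j → 2 * i + (c + j) ≡ c + ((i + j) + i)
  regroup₁ = solve-∀

  regroup₃ : ∀ c i j → suc (2 * i) + (c + j) ≡ c + suc ((i + j) + i)
  regroup₃ = solve-∀

  2c+[c+i]≡3c+i : ∀ c i → 2 * c + (c + i) ≡ 3 * c + i
  2c+[c+i]≡3c+i = solve-∀

  place₂+place₃ : ∀ j → (4 * k + j) + (3 * k + j) ≡ n + (k + suc (2 * j))
  place₂+place₃ = lemma m
    where
    lemma : ∀ a j → (4 * suc a + j) + (3 * suc a + j) ≡ suc ((2 + 3 * a) + (2 + 3 * a)) + (suc a + suc (2 * j))
    lemma = solve-∀

  hEdgeColour : Fin 4 × Fin k → Fin n
  hEdgeColour (t , i) = gk (vertex (i , edgeEnd₁ t)) (vertex (i , edgeEnd₂ t))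

  toℕ-hEdgeColour : ∀ t i → toℕ (hEdgeColour (t , i)) ≡ colourValue t i
  toℕ-hEdgeColour 0F zero rewrite vertex-top = toℕ-⊕ 0F 0F
  toℕ-hEdgeColour 0F i@(suc _) = begin
    toℕ (hEdgeColour (0F , i))           ≡⟨ gk-finite i 0F i 1F (λ ()) (λ ()) ⟩
    (5 * k + j + 2 * toℕ i) % n          ≡⟨ cong (_% n) (regroup₀ (5 * k) (toℕ i) j) ⟩
    (5 * k + (toℕ i + j) + toℕ i) % n    ≡⟨ cong (λ z → (5 * k + z + toℕ i) % n) (toℕ+opposite i) ⟩
    (5 * k + m + toℕ i) % n              ≡⟨ cong (λ z → (z + toℕ i) % n) n≡5k+m ⟨
    (n + toℕ i) % n                      ≡⟨ [n+v]%n≡v (colourValue<n 0F i) ⟩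
    toℕ i                                ∎
    where
    open ≡-Reasoning
    j : ℕ
    j = toℕ (opposite i)
  toℕ-hEdgeColour 1F i = begin
    toℕ (hEdgeColour (1F , i))           ≡⟨ gk-finite i 1F i 2F (λ ()) (λ ()) ⟩
    (2 * toℕ i + (4 * k + j)) % n        ≡⟨ cong (_% n) (regroup₁ (4 * k) (toℕ i) j) ⟩
    (4 * k + ((toℕ i + j) + toℕ i)) % n  ≡⟨ cong (λ z → (4 * k + (z + toℕ i)) % n) (toℕ+opposite i) ⟩
    (4 * k + (m + toℕ i)) % n            ≡⟨ m<n⇒m%n≡m (colourValue<n 1F i) ⟩
    4 * k + (m + toℕ i)                  ∎
    where
    open ≡-Reasoning
    j : ℕ
    j = toℕ (opposite i)
  toℕ-hEdgeColour 2F i = begin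
    toℕ (hEdgeColour (2F , i))           ≡⟨ gk-finite i 2F i 3F (λ ()) (λ ()) ⟩
    (4 * k + j + (3 * k + j)) % n        ≡⟨ cong (_% n) (place₂+place₃ j) ⟩
    (n + (k + suc (2 * j))) % n          ≡⟨ [n+v]%n≡v (colourValue<n 2F i) ⟩
    k + suc (2 * j)                      ∎
    where
    open ≡-Reasoning
    j : ℕ
    j = toℕ (opposite i)
  toℕ-hEdgeColour 3F i = begin
    toℕ (hEdgeColour (3F , i))             ≡⟨ gk-finite i 4F i 5F (λ ()) (λ ()) ⟩
    (suc (2 * toℕ i) + (2 * k + j)) % n     ≡⟨ cong (_% n) (regroup₃ (2 * k) (toℕ i) j) ⟩
    (2 * k + suc ((toℕ i + j) + toℕ i)) % n ≡⟨ cong (λ z → (2 * k + suc (z + toℕ i)) % n) (toℕ+opposite i) ⟩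
    (2 * k + (k + toℕ i)) % n               ≡⟨ cong (_% n) (2c+[c+i]≡3c+i k (toℕ i)) ⟩
    (3 * k + toℕ i) % n                     ≡⟨ m<n⇒m%n≡m (colourValue<n 3F i) ⟩
    3 * k + toℕ i                           ∎
    where
    open ≡-Reasoning
    j : ℕ
    j = toℕ (opposite i)

  hEdgeColour-injective : Injective _≡_ _≡_ hEdgeColour
  hEdgeColour-injective {t , i} {t′ , i′} e =
    colourValue-injective (trans (sym (toℕ-hEdgeColour t i)) (trans (cong toℕ e) (toℕ-hEdgeColour t′ i′)))

  middleEnd : Fin k ⊎ Fin k → X
  middleEnd (inj₁ i) = i , 1F
  middleEnd (inj₂ i) = i , 2F

  middleEnd-injective : Injective _≡_ _≡_ middleEnd
  middleEnd-injective {inj₁ _} {inj₁ _} refl = refl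
  middleEnd-injective {inj₂ _} {inj₂ _} refl = refl

  Aligned : (tA tB : Fin k → Fin (6 * k)) → Set
  Aligned tA tB = Σ[ φ ∈ X ↔ Fin (6 * k) ] (∀ i → Inverse.to φ (i , 1F) ≡ tA i × Inverse.to φ (i , 2F) ≡ tB i)

  middle-aligned : (tA tB : Fin k → Fin (6 * k)) → DisjointEdges tA tB → Aligned tA tB
  middle-aligned tA tB (tA≢tB , tA-injective , tB-injective) = π ↔-∘ base , λ i → aligns (inj₁ i) , aligns (inj₂ i)
    where
    base : X ↔ Fin (6 * k)
    base = positions (lemma m)
      where
      lemma : ∀ a → suc a * 2 + 4 * suc a ≡ 6 * suc a
      lemma = solve-∀
    T-end : Fin k ⊎ Fin k → Fin (6 * k)
    T-end = [ tA , tB ]′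
    T-end-injective : Injective _≡_ _≡_ T-end
    T-end-injective {inj₁ i} {inj₁ j} e = cong inj₁ (tA-injective i j e)
    T-end-injective {inj₁ i} {inj₂ j} e = ⊥-elim (tA≢tB i j e)
    T-end-injective {inj₂ i} {inj₁ j} e = ⊥-elim (tA≢tB j i (sym e))
    T-end-injective {inj₂ i} {inj₂ j} e = cong inj₂ (tB-injective i j e)
    extension : Σ[ π ∈ Permutation′ (6 * k) ] (∀ j → π ⟨$⟩ʳ Inverse.to base (middleEnd (splitAt k j)) ≡ T-end (splitAt k j))
    extension = injections-differ-by-permutation (Inverse.to base ∘ middleEnd ∘ splitAt k) (T-end ∘ splitAt k)
      (↔-injective +↔⊎ ∘ middleEnd-injective ∘ ↔-injective base) (↔-injective +↔⊎ ∘ T-end-injective)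
    π : Permutation′ (6 * k)
    π = proj₁ extension
    aligns : ∀ s → π ⟨$⟩ʳ Inverse.to base (middleEnd s) ≡ T-end s
    aligns s = subst (λ s′ → π ⟨$⟩ʳ Inverse.to base (middleEnd s′) ≡ T-end s′) (splitAt-join k k s) (proj₂ extension (join k k s))

  classCount : 2 * k + 4 * k ≡ n + 1
  classCount = lemma m
    where
    lemma : ∀ a → 2 * suc a + 4 * suc a ≡ suc ((2 + 3 * a) + (2 + 3 * a)) + 1
    lemma = solve-∀

  Sorted : Set
  Sorted = Σ[ Λ ∈ Maybe (Fin n) ↔ (Fin (2 * k) ⊎ Fin (4 * k)) ]
    (∀ e → Inverse.to Λ (just (hEdgeColour e)) ≡ inj₂ (uncurry combine e))

  edge-sorted : Sorted
  edge-sorted = +↔⊎ ↔-∘ (cast-id (sym classCount) ↔-∘ (π ↔-∘ ↔-sym Fin+1↔Maybe)) , sorts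
    where
    code : Fin (4 * k) → Fin (n + 1)
    code = Inverse.from Fin+1↔Maybe ∘ just ∘ hEdgeColour ∘ remQuot k
    code-injective : Injective _≡_ _≡_ code
    code-injective = ↔-injective *↔× ∘ hEdgeColour-injective ∘ just-injective ∘ ↔-injective (↔-sym Fin+1↔Maybe)
    target : Fin (4 * k) → Fin (n + 1)
    target = cast classCount ∘ (2 * k ↑ʳ_)
    target-injective : Injective _≡_ _≡_ target
    target-injective = ↑ʳ-injective (2 * k) _ _ ∘ ↔-injective (cast-id classCount)
    extension : Σ[ π ∈ Permutation′ (n + 1) ] (∀ j → π ⟨$⟩ʳ code j ≡ target j)
    extension = injections-differ-by-permutation code target code-injective target-injective
    π : Permutation′ (n + 1)
    π = proj₁ extension
    sorts : ∀ e → splitAt (2 * k) (cast (sym classCount) (π ⟨$⟩ʳ Inverse.from Fin+1↔Maybe (just (hEdgeColour e))))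
                  ≡ inj₂ (uncurry combine e)
    sorts e = begin
      splitAt (2 * k) (cast (sym classCount) (π ⟨$⟩ʳ Inverse.from Fin+1↔Maybe (just (hEdgeColour e))))
        ≡⟨ cong (λ e′ → splitAt (2 * k) (cast (sym classCount) (π ⟨$⟩ʳ Inverse.from Fin+1↔Maybe (just (hEdgeColour e′)))))
                (remQuot-combine {4} {k} (proj₁ e) (proj₂ e)) ⟨
      splitAt (2 * k) (cast (sym classCount) (π ⟨$⟩ʳ code (uncurry combine e)))
        ≡⟨ cong (splitAt (2 * k) ∘ cast (sym classCount)) (proj₂ extension (uncurry combine e)) ⟩
      splitAt (2 * k) (cast (sym classCount) (cast classCount (2 * k ↑ʳ uncurry combine e)))
        ≡⟨ cong (splitAt (2 * k)) (cast-involutive (sym classCount) classCount _) ⟩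
      splitAt (2 * k) (2 * k ↑ʳ uncurry combine e)
        ≡⟨ splitAt-↑ʳ (2 * k) (4 * k) (uncurry combine e) ⟩
      inj₂ (uncurry combine e) ∎
      where open ≡-Reasoning

module Decomposition (m : ℕ) (tA tB : Fin (suc m) → Fin (6 * suc m))
  (aligned : Layout.Aligned m tA tB) (sorted : Layout.Sorted m) where

  open Layout m

  φ : X ↔ Fin (6 * k)
  φ = proj₁ aligned

  open Inverse φ using () renaming (to to φ⁺; from to φ⁻; strictlyInverseˡ to φ⁺φ⁻; strictlyInverseʳ to φ⁻φ⁺)
  open Inverse (proj₁ sorted) using () renaming (to to Λ⁺; from to Λ⁻; strictlyInverseˡ to Λ⁺Λ⁻)

  φ⁺-injective : Injective _≡_ _≡_ φ⁺
  φ⁺-injective = ↔-injective φ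

  tA≡φ : ∀ i → tA i ≡ φ⁺ (i , 1F)
  tA≡φ i = sym (proj₁ (proj₂ aligned i))

  tB≡φ : ∀ i → tB i ≡ φ⁺ (i , 2F)
  tB≡φ i = sym (proj₂ (proj₂ aligned i))

  colour : Fin (6 * k) → Fin (6 * k) → Fin n
  colour u v = gk (vertex (φ⁻ u)) (vertex (φ⁻ v))

  colour-isOneFactorization : IsOneFactorization colour
  colour-isOneFactorization = isOneFactorization-pullback (vertices ↔-∘ ↔-sym φ) gk-isOneFactorization

  colour-φ : ∀ x y → colour (φ⁺ x) (φ⁺ y) ≡ gk (vertex x) (vertex y)
  colour-φ x y = cong₂ (λ x y → gk (vertex x) (vertex y)) (φ⁻φ⁺ x) (φ⁻φ⁺ y)

  mate : Fin (6 * k) → Fin (6 * k)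
  mate u = φ⁺ (map₂ partner (φ⁻ u))

  mate-φ : ∀ i r → mate (φ⁺ (i , r)) ≡ φ⁺ (i , partner r)
  mate-φ i r = cong (φ⁺ ∘ map₂ partner) (φ⁻φ⁺ (i , r))

  mate-involutive : ∀ u → mate (mate u) ≡ u
  mate-involutive u = begin
    φ⁺ (map₂ partner (φ⁻ (φ⁺ (map₂ partner (φ⁻ u))))) ≡⟨ cong (φ⁺ ∘ map₂ partner) (φ⁻φ⁺ _) ⟩
    φ⁺ (map₂ (partner ∘ partner) (φ⁻ u))              ≡⟨ cong (λ r → φ⁺ (proj₁ (φ⁻ u) , r)) (partner-involutive _) ⟩
    φ⁺ (φ⁻ u)                                         ≡⟨ φ⁺φ⁻ u ⟩
    u                                                 ∎
    where open ≡-Reasoning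

  mate-irreflexive : ∀ u → u ≢ mate u
  mate-irreflexive u e = partner-irreflexive (proj₂ (φ⁻ u)) (cong proj₂ (trans (cong φ⁻ e) (φ⁻φ⁺ _)))

  hEnd₁ hEnd₂ : Fin 4 × Fin k → X
  hEnd₁ (t , i) = i , edgeEnd₁ t
  hEnd₂ (t , i) = i , edgeEnd₂ t

  end₁ end₂ : Fin 4 × Fin k → Fin (6 * k)
  end₁ = φ⁺ ∘ hEnd₁
  end₂ = φ⁺ ∘ hEnd₂

  ends-distinct : ∀ e → end₁ e ≢ end₂ e
  ends-distinct (t , i) e = edgeEnds-distinct t (cong proj₂ (φ⁺-injective e))

  edgeColour≡hEdgeColour : ∀ e → colour (end₁ e) (end₂ e) ≡ hEdgeColour e
  edgeColour≡hEdgeColour e = colour-φ (hEnd₁ e) (hEnd₂ e)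

  edgeColour-injective : ∀ {e e′} → colour (end₁ e) (end₂ e) ≡ colour (end₁ e′) (end₂ e′) → e ≡ e′
  edgeColour-injective {e} {e′} c≡c′ =
    hEdgeColour-injective (trans (sym (edgeColour≡hEdgeColour e)) (trans c≡c′ (edgeColour≡hEdgeColour e′)))

  T⊆H : ∀ {u v} → TEdge tA tB u v → ∃[ e ] Pair (end₁ e) (end₂ e) u v
  T⊆H (i , p) rewrite tA≡φ i | tB≡φ i = (1F , i) , p

  M⊆H : ∀ u → ∃[ e ] Pair (end₁ e) (end₂ e) u (mate u)
  M⊆H u with partner-edge (proj₂ (φ⁻ u))
  ... | t , p = (t , i) , subst (λ w → Pair (end₁ (t , i)) (end₂ (t , i)) w (mate u)) (φ⁺φ⁻ u) (Pair-map (λ r → φ⁺ (i , r)) p)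
    where
    i : Fin k
    i = proj₁ (φ⁻ u)

  H⊆T∪M : ∀ e → TEdge tA tB (end₁ e) (end₂ e) ⊎ end₂ e ≡ mate (end₁ e)
  H⊆T∪M (t , i) with edge-middle-or-partner t
  ... | inj₁ refl = inj₁ (i , inj₁ (sym (tA≡φ i) , sym (tB≡φ i)))
  ... | inj₂ e    = inj₂ (trans (cong (λ r → φ⁺ (i , r)) e) (sym (mate-φ i (edgeEnd₁ t))))

  T∩M≡∅ : ∀ u → ¬ TEdge tA tB u (mate u)
  T∩M≡∅ u (i , inj₁ (refl , e))
    with () ← φ⁺-injective (trans (sym (mate-φ i 1F)) (trans (cong mate (sym (tA≡φ i))) (trans e (tB≡φ i))))
  T∩M≡∅ u (i , inj₂ (refl , e))
    with () ← φ⁺-injective (trans (sym (mate-φ i 2F)) (trans (cong mate (sym (tB≡φ i))) (trans e (tA≡φ i))))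

  open NearFactorization tA tB colour-isOneFactorization mate mate-involutive mate-irreflexive
    end₁ end₂ ends-distinct edgeColour-injective T⊆H M⊆H H⊆T∪M T∩M≡∅ Λ⁺ (↔-injective (proj₁ sorted))
    public

  Λ-edgeColour : ∀ e → Λ⁺ (just (edgeColour e)) ≡ inj₂ (uncurry combine e)
  Λ-edgeColour e = trans (cong (Λ⁺ ∘ just) (edgeColour≡hEdgeColour e)) (proj₂ sorted e)

  perfect : ∀ j → IsPerfectMatching (ClassEdge tA tB label (inj₁ j))
  perfect j = subst (IsPerfectMatching ∘ ClassEdge tA tB label) (Λ⁺Λ⁻ (inj₁ j)) (class-perfect (Λ⁻ (inj₁ j)) avoids)
    where
    avoids : ∀ e → Λ⁻ (inj₁ j) ≢ just (edgeColour e)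
    avoids e eq with () ← trans (sym (Λ⁺Λ⁻ (inj₁ j))) (trans (cong Λ⁺ eq) (Λ-edgeColour e))

  a b : Fin (4 * k) → Fin (6 * k)
  a = end₁ ∘ remQuot k
  b = end₂ ∘ remQuot k

  nearFactor : ∀ j → IsNearFactorMissing (ClassEdge tA tB label (inj₂ j)) (a j) (b j)
  nearFactor j = subst (λ d → IsNearFactorMissing (ClassEdge tA tB label d) (a j) (b j))
    (trans (Λ-edgeColour (remQuot k j)) (cong inj₂ (combine-remQuot {4} k j)))
    (class-nearFactor (remQuot k j))

  HEdge⇔uncovered : ∀ x y → HEdge x y ⇔ UncoveredEdge a b (φ⁺ x) (φ⁺ y)
  HEdge⇔uncovered (i , r) (i′ , r′) = mk⇔ to from
    where
    to : HEdge (i , r) (i′ , r′) → UncoveredEdge a b (φ⁺ (i , r)) (φ⁺ (i′ , r′))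
    to (refl , hb) with Equivalence.to (H-base⇔edge r r′) hb
    ... | t , p = combine t i , subst (λ e → Pair (end₁ e) (end₂ e) (φ⁺ (i , r)) (φ⁺ (i , r′)))
                                      (sym (remQuot-combine t i)) (Pair-map (λ s → φ⁺ (i , s)) p)
    fromPair : ∀ e → Pair (hEnd₁ e) (hEnd₂ e) (i , r) (i′ , r′) → HEdge (i , r) (i′ , r′)
    fromPair (t , _) (inj₁ (refl , refl)) = refl , Equivalence.from (H-base⇔edge r r′) (t , inj₁ (refl , refl))
    fromPair (t , _) (inj₂ (refl , refl)) = refl , Equivalence.from (H-base⇔edge r r′) (t , inj₂ (refl , refl))
    from : UncoveredEdge a b (φ⁺ (i , r)) (φ⁺ (i′ , r′)) → HEdge (i , r) (i′ , r′)
    from (j , p) = fromPair (remQuot k j) (Pair-unmap φ⁺-injective p)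

  HMiddle⇔T : ∀ x y → HMiddle x y ⇔ TEdge tA tB (φ⁺ x) (φ⁺ y)
  HMiddle⇔T (i , r) (i′ , r′) = mk⇔ to from
    where
    to : HMiddle (i , r) (i′ , r′) → TEdge tA tB (φ⁺ (i , r)) (φ⁺ (i′ , r′))
    to (refl , p) = i , subst₂ (λ p q → Pair p q _ _) (sym (tA≡φ i)) (sym (tB≡φ i)) (Pair-map (λ s → φ⁺ (i , s)) p)
    fromPair : ∀ l → Pair (l , 1F) (l , 2F) (i , r) (i′ , r′) → HMiddle (i , r) (i′ , r′)
    fromPair _ (inj₁ (refl , refl)) = refl , inj₁ (refl , refl)
    fromPair _ (inj₂ (refl , refl)) = refl , inj₂ (refl , refl)
    from : TEdge tA tB (φ⁺ (i , r)) (φ⁺ (i′ , r′)) → HMiddle (i , r) (i′ , r′)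
    from (l , p) = fromPair l (Pair-unmap φ⁺-injective (subst₂ (λ p q → Pair p q _ _) (tA≡φ l) (tB≡φ l) p))

lemma9 : (k : ℕ) → 1 ≤ k →
    (tA tB : Fin k → Fin (6 * k)) → DisjointEdges tA tB →
    ∃[ c ] (SymmetricLabel {6 * k} {Fin (2 * k) ⊎ Fin (4 * k)} c ×
      (∀ (i : Fin (2 * k)) → IsPerfectMatching (ClassEdge tA tB c (inj₁ i))) ×
      ∃[ a ] ∃[ b ]
        ((∀ (i : Fin (4 * k)) → IsNearFactorMissing (ClassEdge tA tB c (inj₂ i)) (a i) (b i)) ×
         Σ[ φ ∈ (Fin k × Fin 6) ⤖ Fin (6 * k) ]
           ((∀ x y → HEdge x y ⇔ UncoveredEdge a b (Bijection.to φ x) (Bijection.to φ y)) ×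
            (∀ x y → HMiddle x y ⇔ TEdge tA tB (Bijection.to φ x) (Bijection.to φ y)))))
lemma9 zero    ()
lemma9 (suc m) _ tA tB disjoint =
  label , label-symmetric , perfect , a , b , nearFactor , ↔⇒⤖ φ , HEdge⇔uncovered , HMiddle⇔T
  where
  open Decomposition m tA tB (Layout.middle-aligned m tA tB disjoint) (Layout.edge-sorted m)
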